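{- Let $G$ be the $X$-flip of a path $P$ for a set $X\subseteq V(P)$. Let $a,b\in X$ with $N_P[a]\cap N_P[b]=\emptyset$, and let $P'$ be the graph obtained from $P-\{a,b\}$ by making each of $N_P(a)$ and $N_P(b)$ a clique. Then $G\wedge ab-\{a,b\}$ is the $(X\triangle N_P[\{a,b\}])$-flip of $P'$.
   Context: Graphs are finite and simple. $N_P(v)$ and $N_P[v]$ are the open and closed neighborhoods in $P$; $N_P[S]=\bigcup_{v\in S}N_P[v]$; $\triangle$ is symmetric difference. For a graph $H$ and $Y\subseteq V(H)$, the $Y$-flip of $H$ is the graph on $V(H)$ obtained by complementing the edge relation between pairs of distinct vertices both in $Y$ (the $\emptyset$-flip is $H$). Local complementation: $G\ast x:=(V(G),E(G)\triangle\{yz:y,z\in N_G(x),y\neq z\})$; pivoting an edge $uv$: $G\wedge uv:=G\ast u\ast v\ast u$. (Here $a,b$ are adjacent in $G$ since they are non-adjacent in $P$ and both lie in $X$.) -}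

module Defs where

open import Data.Nat using (ℕ; suc)
open import Data.Fin using (Fin; toℕ; _≟_)
open import Data.Bool using (Bool; true; false; _∧_; _∨_; _xor_; not; if_then_else_)
open import Data.Product using (Σ; _×_)
open import Data.Sum using (_⊎_)
open import Relation.Nullary using (¬_)
open import Relation.Nullary.Decidable using (⌊_⌋)
open import Relation.Binary.PropositionalEquality using (_≡_)
open import Function.Definitions using (Bijective)
open import Function.Bundles using (_⇔_)

-- A (raw) graph on vertex set Fin n, given by its Boolean adjacency relation.
Graph : ℕ → Set
Graph n = Fin n → Fin n → Bool

VSet : ℕ → Set
VSet n = Fin n → Bool

_==_ : ∀ {n} → Fin n → Fin n → Bool
u == v = ⌊ u ≟ v ⌋

_=/=_ : ∀ {n} → Fin n → Fin n → Bool
u =/= v = not (u == v)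

IsPath : ∀ {n} → Graph n → Set
IsPath {n} P = Σ (Fin n → Fin n) λ σ →
  Bijective _≡_ _≡_ σ ×
  (∀ i j → (P (σ i) (σ j) ≡ true) ⇔ (suc (toℕ i) ≡ toℕ j ⊎ suc (toℕ j) ≡ toℕ i))

N : ∀ {n} → Graph n → Fin n → VSet n
N H x v = H x v

N[_] : ∀ {n} → Graph n → Fin n → VSet n
N[ H ] x v = (v == x) ∨ H x v

N[_]₂ : ∀ {n} → Graph n → Fin n → Fin n → VSet n
N[ H ]₂ a b v = N[ H ] a v ∨ N[ H ] b v

_△_ : ∀ {n} → VSet n → VSet n → VSet n
(X △ Y) v = X v xor Y v

flip : ∀ {n} → VSet n → Graph n → Graph n
flip Y H u v = if (u =/= v) ∧ Y u ∧ Y v then not (H u v) else H u v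

_✱_ : ∀ {n} → Graph n → Fin n → Graph n
(G ✱ x) y z = G y z xor ((y =/= z) ∧ G x y ∧ G x z)

pivot : ∀ {n} → Graph n → Fin n → Fin n → Graph n
pivot G u v = ((G ✱ u) ✱ v) ✱ u

-- P' : on the vertices other than a,b: P restricted, plus N_P(a) and N_P(b)
-- made into cliques. (Only its values on V(P) ∖ {a,b} are used.)
P′ : ∀ {n} → Graph n → Fin n → Fin n → Graph n
P′ P a b u v = P u v ∨ ((u =/= v) ∧ ((N P a u ∧ N P a v) ∨ (N P b u ∧ N P b v)))

-- Pivoting an edge ab acts on pairs u, v outside {a, b} as G∧ab (u,v) = G(u,v) + G(a,u)G(b,v) + G(a,v)G(b,u)
-- over GF(2). For G the X-flip of a path, with a, b ∈ X, each adjacency G(x,y) is P(x,y) + X(x)X(y), and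
-- the pivot becomes a polynomial identity in seven Boolean variables. The shape of P′ and of the new flip
-- set is then matched by turning each ∨ into a xor: the closed neighbourhoods of a and b are disjoint, and
-- a path has no triangles.
module Submission where

open import Defs
open import Data.Fin using (Fin; toℕ; _≟_)
open import Data.Nat using (ℕ; suc)
open import Data.Nat.Properties using (1+n≢n)
open import Data.Bool using (Bool; true; false; _∧_; _∨_; _xor_; not; if_then_else_)
open import Data.Bool.Properties using (¬-not; ∧-zeroʳ; ∨-zeroʳ; ∧-conicalˡ; ∧-conicalʳ; xor-identityʳ; ∧-distribˡ-xor)
open import Data.Bool.Solver using (module xor-∧-Solver)
open import Data.Empty using (⊥)
open import Data.Product using (Σ-syntax; _,_; proj₁; proj₂)
open import Data.Sum using (_⊎_; inj₁; inj₂)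
open import Relation.Nullary using (¬_; yes; no; contradiction)
open import Relation.Binary.PropositionalEquality
  using (_≡_; _≢_; refl; trans; cong; cong₂; ≢-sym; module ≡-Reasoning)
open import Function.Bundles using (Equivalence)

open ≡-Reasoning

∨≡xor : ∀ x y → x ∧ y ≡ false → x ∨ y ≡ x xor y
∨≡xor true  true  ()
∨≡xor true  false _ = refl
∨≡xor false _     _ = refl

if-not≡xor : ∀ c p → (if c then not p else p) ≡ p xor c
if-not≡xor true  true  = refl
if-not≡xor true  false = refl
if-not≡xor false true  = refl
if-not≡xor false false = refl

==-≢ : ∀ {n} {u v : Fin n} → u ≢ v → (u == v) ≡ false
==-≢ {u = u} {v} u≢v with u ≟ v
... | yes u≡v = contradiction u≡v u≢v
... | no  _   = refl

==-refl : ∀ {n} (u : Fin n) → (u == u) ≡ true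
==-refl u with u ≟ u
... | yes _   = refl
... | no  u≢u = contradiction refl u≢u

=/=-≢ : ∀ {n} {u v : Fin n} → u ≢ v → (u =/= v) ≡ true
=/=-≢ u≢v = cong not (==-≢ u≢v)

N[]-≢ : ∀ {n} (H : Graph n) {x w : Fin n} → w ≢ x → N[ H ] x w ≡ H x w
N[]-≢ H {x} {w} w≢x = cong (_∨ H x w) (==-≢ w≢x)

N[]-self : ∀ {n} (H : Graph n) (x : Fin n) → N[ H ] x x ≡ true
N[]-self H x rewrite ==-refl x = refl

N[]-adjacent : ∀ {n} (H : Graph n) {x w : Fin n} → H x w ≡ true → N[ H ] x w ≡ true
N[]-adjacent H {x} {w} e rewrite e = ∨-zeroʳ (w == x)

flip-≢ : ∀ {n} (Y : VSet n) (H : Graph n) {u v : Fin n} → u ≢ v → flip Y H u v ≡ H u v xor (Y u ∧ Y v)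
flip-≢ Y H {u} {v} u≢v rewrite =/=-≢ u≢v = if-not≡xor (Y u ∧ Y v) (H u v)

flip-≢-member : ∀ {n} (Y : VSet n) (H : Graph n) {x w : Fin n} → Y x ≡ true → w ≢ x
              → flip Y H x w ≡ H x w xor Y w
flip-≢-member Y H {x} {w} Yx w≢x rewrite flip-≢ Y H (≢-sym w≢x) | Yx = refl

flip-diagonal : ∀ {n} (Y : VSet n) (H : Graph n) (u : Fin n) → flip Y H u u ≡ H u u
flip-diagonal Y H u rewrite ==-refl u = refl

✱-≢ : ∀ {n} (G : Graph n) (x : Fin n) {y z : Fin n} → y ≢ z → (G ✱ x) y z ≡ G y z xor (G x y ∧ G x z)
✱-≢ G x {y} {z} y≢z = cong (λ d → G y z xor (d ∧ G x y ∧ G x z)) (=/=-≢ y≢z)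

✱-row : ∀ {n} (G : Graph n) {x : Fin n} → G x x ≡ false → ∀ z → (G ✱ x) x z ≡ G x z
✱-row G {x} Gxx z rewrite Gxx | ∧-zeroʳ (x =/= z) = xor-identityʳ (G x z)

✱-column : ∀ {n} (G : Graph n) {x : Fin n} → G x x ≡ false → ∀ y → (G ✱ x) y x ≡ G y x
✱-column G {x} Gxx y rewrite Gxx | ∧-zeroʳ (G x y) | ∧-zeroʳ (y =/= x) = xor-identityʳ (G y x)

module _ {n} (G : Graph n) {a b : Fin n}
         (Gaa : G a a ≡ false) (Gab : G a b ≡ true) (Gba : G b a ≡ true) where

  private
    G₁ G₂ : Graph n
    G₁ = G ✱ a
    G₂ = G₁ ✱ b

    G₁-b : ∀ {w} → w ≢ b → G₁ b w ≡ G b w xor G a w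
    G₁-b {w} w≢b rewrite ✱-≢ G a (≢-sym w≢b) | Gab = refl

    G₂-a : ∀ {w} → w ≢ a → w ≢ b → G₂ a w ≡ G b w
    G₂-a {w} w≢a w≢b = begin
      G₂ a w                                    ≡⟨ ✱-≢ G₁ b (≢-sym w≢a) ⟩
      G₁ a w xor (G₁ b a ∧ G₁ b w)              ≡⟨ cong₂ (λ p q → p xor (q ∧ G₁ b w)) (✱-row G Gaa w) (✱-column G Gaa b) ⟩
      G a w xor (G b a ∧ G₁ b w)                ≡⟨ cong₂ (λ p q → G a w xor (p ∧ q)) Gba (G₁-b w≢b) ⟩
      G a w xor (G b w xor G a w)               ≡⟨ solve 2 (λ x y → x :+ (y :+ x) := y) refl (G a w) (G b w) ⟩
      G b w                                     ∎
      where open xor-∧-Solver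

  pivot-≢ : ∀ {u v} → u ≢ a → u ≢ b → v ≢ a → v ≢ b → u ≢ v
          → pivot G a b u v ≡ G u v xor (G a u ∧ G b v xor G a v ∧ G b u)
  pivot-≢ {u} {v} u≢a u≢b v≢a v≢b u≢v = begin
    pivot G a b u v                             ≡⟨ ✱-≢ G₂ a u≢v ⟩
    G₂ u v xor (G₂ a u ∧ G₂ a v)                ≡⟨ cong₂ (λ p q → G₂ u v xor (p ∧ q)) (G₂-a u≢a u≢b) (G₂-a v≢a v≢b) ⟩
    G₂ u v xor (G b u ∧ G b v)                  ≡⟨ cong (_xor (G b u ∧ G b v)) (✱-≢ G₁ b u≢v) ⟩
    (G₁ u v xor (G₁ b u ∧ G₁ b v)) xor (G b u ∧ G b v)
      ≡⟨ cong₂ (λ p q → (G₁ u v xor (p ∧ q)) xor (G b u ∧ G b v)) (G₁-b u≢b) (G₁-b v≢b) ⟩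
    (G₁ u v xor ((G b u xor G a u) ∧ (G b v xor G a v))) xor (G b u ∧ G b v)
      ≡⟨ cong (λ p → (p xor ((G b u xor G a u) ∧ (G b v xor G a v))) xor (G b u ∧ G b v)) (✱-≢ G a u≢v) ⟩
    ((G u v xor (G a u ∧ G a v)) xor ((G b u xor G a u) ∧ (G b v xor G a v))) xor (G b u ∧ G b v)
      ≡⟨ solve 5 (λ uv au av bu bv →
           ((uv :+ (au :* av)) :+ ((bu :+ au) :* (bv :+ av))) :+ (bu :* bv)
           := uv :+ ((au :* bv) :+ (av :* bu))) refl (G u v) (G a u) (G a v) (G b u) (G b v) ⟩
    G u v xor (G a u ∧ G b v xor G a v ∧ G b u) ∎
    where open xor-∧-Solver

flip-pivot-identity : ∀ {guv gau gav gbu gbv p′ x′u x′v} (puv pau pav pbu pbv xu xv : Bool)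
  → guv ≡ puv xor (xu ∧ xv)
  → gau ≡ pau xor xu → gav ≡ pav xor xv → gbu ≡ pbu xor xu → gbv ≡ pbv xor xv
  → p′ ≡ puv xor (pau ∧ pav xor pbu ∧ pbv)
  → x′u ≡ xu xor (pau xor pbu) → x′v ≡ xv xor (pav xor pbv)
  → guv xor (gau ∧ gbv xor gav ∧ gbu) ≡ p′ xor (x′u ∧ x′v)
flip-pivot-identity puv pau pav pbu pbv xu xv refl refl refl refl refl refl refl refl =
  solve 7 (λ puv pau pav pbu pbv xu xv →
      (puv :+ (xu :* xv)) :+ ((pau :+ xu) :* (pbv :+ xv) :+ (pav :+ xv) :* (pbu :+ xu))
    := (puv :+ (pau :* pav :+ pbu :* pbv)) :+ ((xu :+ (pau :+ pbu)) :* (xv :+ (pav :+ pbv))))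
    refl puv pau pav pbu pbv xu xv
  where open xor-∧-Solver

_∼_ : ℕ → ℕ → Set
i ∼ j = suc i ≡ j ⊎ suc j ≡ i

∼-irrefl : ∀ i → ¬ i ∼ i
∼-irrefl i (inj₁ e) = 1+n≢n e
∼-irrefl i (inj₂ e) = 1+n≢n e

-- Two neighbours of the same number differ by 0 or 2, never by 1.
∼-triangle-free : ∀ {i j k} → i ∼ j → k ∼ i → k ∼ j → ⊥
∼-triangle-free (inj₁ refl) (inj₁ refl) (inj₁ ())
∼-triangle-free (inj₁ refl) (inj₁ refl) (inj₂ ())
∼-triangle-free (inj₁ refl) (inj₂ refl) (inj₁ ())
∼-triangle-free (inj₁ refl) (inj₂ refl) (inj₂ ())
∼-triangle-free (inj₂ refl) (inj₁ refl) (inj₁ ())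
∼-triangle-free (inj₂ refl) (inj₁ refl) (inj₂ ())
∼-triangle-free (inj₂ refl) (inj₂ refl) (inj₁ ())
∼-triangle-free (inj₂ refl) (inj₂ refl) (inj₂ ())

module IsPath-properties {n} (P : Graph n) (path : IsPath P) where

  private
    σ : Fin n → Fin n
    σ = proj₁ path

    label : ∀ x → Σ[ i ∈ Fin n ] σ i ≡ x
    label x = let (i , σi≡x) = proj₂ (proj₁ (proj₂ path)) x in i , σi≡x refl

    adjacent⇒∼ : ∀ i j → P (σ i) (σ j) ≡ true → toℕ i ∼ toℕ j
    adjacent⇒∼ i j = Equivalence.to (proj₂ (proj₂ path) i j)

  irreflexive : ∀ x → P x x ≡ false
  irreflexive x with label x
  ... | i , refl = ¬-not λ e → ∼-irrefl (toℕ i) (adjacent⇒∼ i i e)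

  triangle-free : ∀ x y z → P x y ∧ (P z x ∧ P z y) ≡ false
  triangle-free x y z with label x | label y | label z
  ... | i , refl | j , refl | k , refl = ¬-not λ e →
    let zxy = ∧-conicalʳ (P (σ i) (σ j)) _ e in
    ∼-triangle-free (adjacent⇒∼ i j (∧-conicalˡ _ _ e))
                    (adjacent⇒∼ k i (∧-conicalˡ (P (σ k) (σ i)) _ zxy))
                    (adjacent⇒∼ k j (∧-conicalʳ (P (σ k) (σ i)) _ zxy))

module Disjoint-closed-neighbourhoods {n} (P : Graph n) (path : IsPath P) {a b : Fin n}
         (disjoint : ∀ v → N[ P ] a v ≡ true → N[ P ] b v ≡ true → ⊥) where

  open IsPath-properties P path

  no-common-neighbour : ∀ {w} → P a w ≡ true → P b w ≡ true → ⊥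
  no-common-neighbour {w} Paw Pbw = disjoint w (N[]-adjacent P Paw) (N[]-adjacent P Pbw)

  a≢b : a ≢ b
  a≢b refl = disjoint a (N[]-self P a) (N[]-self P a)

  Pab : P a b ≡ false
  Pab = ¬-not λ e → disjoint b (N[]-adjacent P e) (N[]-self P b)

  Pba : P b a ≡ false
  Pba = ¬-not λ e → disjoint a (N[]-self P a) (N[]-adjacent P e)

  N[]₂-≢ : ∀ {w} → w ≢ a → w ≢ b → N[ P ]₂ a b w ≡ P a w xor P b w
  N[]₂-≢ {w} w≢a w≢b = begin
    N[ P ] a w ∨ N[ P ] b w  ≡⟨ cong₂ _∨_ (N[]-≢ P w≢a) (N[]-≢ P w≢b) ⟩
    P a w ∨ P b w            ≡⟨ ∨≡xor (P a w) (P b w) a-disjoint-b ⟩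
    P a w xor P b w          ∎
    where
    a-disjoint-b : P a w ∧ P b w ≡ false
    a-disjoint-b = ¬-not λ e → no-common-neighbour (∧-conicalˡ _ _ e) (∧-conicalʳ (P a w) _ e)

  P′-≢ : ∀ {u v} → u ≢ v → P′ P a b u v ≡ P u v xor (P a u ∧ P a v xor P b u ∧ P b v)
  P′-≢ {u} {v} u≢v = begin
    P u v ∨ ((u =/= v) ∧ (P a u ∧ P a v ∨ P b u ∧ P b v))
      ≡⟨ cong (λ d → P u v ∨ (d ∧ (P a u ∧ P a v ∨ P b u ∧ P b v))) (=/=-≢ u≢v) ⟩
    P u v ∨ (P a u ∧ P a v ∨ P b u ∧ P b v)
      ≡⟨ cong (P u v ∨_) (∨≡xor (P a u ∧ P a v) (P b u ∧ P b v) a-clique-disjoint-b-clique) ⟩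
    P u v ∨ (P a u ∧ P a v xor P b u ∧ P b v)
      ≡⟨ ∨≡xor (P u v) (P a u ∧ P a v xor P b u ∧ P b v) no-triangle ⟩
    P u v xor (P a u ∧ P a v xor P b u ∧ P b v)  ∎
    where
    a-clique-disjoint-b-clique : (P a u ∧ P a v) ∧ (P b u ∧ P b v) ≡ false
    a-clique-disjoint-b-clique = ¬-not λ e →
      no-common-neighbour (∧-conicalˡ (P a u) _ (∧-conicalˡ _ _ e))
                          (∧-conicalˡ (P b u) _ (∧-conicalʳ (P a u ∧ P a v) _ e))

    no-triangle : P u v ∧ (P a u ∧ P a v xor P b u ∧ P b v) ≡ false
    no-triangle rewrite ∧-distribˡ-xor (P u v) (P a u ∧ P a v) (P b u ∧ P b v)
                      | triangle-free u v a | triangle-free u v b = refl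

lemma4p2 : ∀ {n : ℕ} (P : Graph n) (X : VSet n) (a b : Fin n)
    → IsPath P
    → X a ≡ true → X b ≡ true
    → (∀ v → N[ P ] a v ≡ true → N[ P ] b v ≡ true → ⊥)
    → ∀ u v → ¬ u ≡ a → ¬ u ≡ b → ¬ v ≡ a → ¬ v ≡ b → ¬ u ≡ v
    → pivot (flip X P) a b u v ≡ flip (X △ N[ P ]₂ a b) (P′ P a b) u v
lemma4p2 {n} P X a b path Xa Xb disjoint u v u≢a u≢b v≢a v≢b u≢v = begin
  pivot G a b u v                                ≡⟨ pivot-≢ G Gaa Gab Gba u≢a u≢b v≢a v≢b u≢v ⟩
  G u v xor (G a u ∧ G b v xor G a v ∧ G b u)    ≡⟨ flip-pivot-identity (P u v) (P a u) (P a v) (P b u) (P b v) (X u) (X v)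
                                                      (flip-≢ X P u≢v)
                                                      (G-≢ Xa u≢a) (G-≢ Xa v≢a) (G-≢ Xb u≢b) (G-≢ Xb v≢b)
                                                      (P′-≢ u≢v) (X′-≢ u≢a u≢b) (X′-≢ v≢a v≢b) ⟩
  P′ P a b u v xor (X′ u ∧ X′ v)                 ≡⟨ flip-≢ X′ (P′ P a b) u≢v ⟨
  flip X′ (P′ P a b) u v                         ∎
  where
  open IsPath-properties P path
  open Disjoint-closed-neighbourhoods P path disjoint

  G : Graph n
  G = flip X P

  X′ : VSet n
  X′ = X △ N[ P ]₂ a b

  G-≢ : ∀ {x w} → X x ≡ true → w ≢ x → G x w ≡ P x w xor X w
  G-≢ = flip-≢-member X P

  X′-≢ : ∀ {w} → w ≢ a → w ≢ b → X′ w ≡ X w xor (P a w xor P b w)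
  X′-≢ {w} w≢a w≢b = cong (X w xor_) (N[]₂-≢ w≢a w≢b)

  Gaa : G a a ≡ false
  Gaa = trans (flip-diagonal X P a) (irreflexive a)

  Gab : G a b ≡ true
  Gab rewrite G-≢ Xa (≢-sym a≢b) | Pab | Xb = refl

  Gba : G b a ≡ true
  Gba rewrite G-≢ Xb a≢b | Pba | Xa = refl
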